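{- Let $T'$ be a plane tree on $d$ vertices and $p$ an integer with $2\le p\le d$. Then there is a unique (up to isomorphism of plane trees) plane tree $T$ on $d+1$ vertices such that the vertex $u$ of $T$ with postorder label $p$ is a type $[1]$ special vertex and removing $u$ from $T$ yields $T'$. Furthermore, for each $\tau\in\{0,1,2\}$ and each nonroot vertex $v\ne u$ of $T$ with postorder label at most $p-1$, $v$ is a type $[\tau]$ special vertex in $T$ if and only if it is a type $[\tau]$ special vertex in $T'$.
   Context: A plane tree is a rooted tree whose children at each vertex are linearly ordered left to right; the first is the leftmost child; a leaf has no children. Postorder labeling of a plane tree on $n$ vertices: remove the root, label the subtrees rooted at the root's children, left to right, consecutively and each recursively in postorder, then give the root label $n$. Removal of a nonroot vertex $v$ with parent $w$: delete $v$ and replace $v$ in the ordered list of children of $w$ by the ordered list of children of $v$. Special vertices: type $[0]$: a leaf that is the leftmost child of its parent; type $[1]$: a leaf that is not the leftmost child of its parent; type $[2]$: a non-leaf that is the leftmost child of its parent. -}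

module Defs where

open import Data.Nat using (ℕ; zero; suc; _+_; _∸_; _<ᵇ_)
open import Data.List using (List; []; _∷_; _++_; [_])
open import Data.Maybe using (Maybe; just; nothing)
open import Data.Product using (Σ; ∃; _×_; _,_)
open import Data.Empty using (⊥)
open import Relation.Binary.PropositionalEquality using (_≡_; _≢_)

-- A plane tree: a root with an ordered (left to right) list of subtrees.
-- Plane trees up to isomorphism of plane trees are exactly the elements of
-- this type up to propositional equality.
data Tree : Set where
  node : List Tree → Tree

children : Tree → List Tree
children (node cs) = cs

mutual
  size : Tree → ℕ
  size (node cs) = suc (sizeF cs)

  sizeF : List Tree → ℕ
  sizeF [] = 0
  sizeF (t ∷ ts) = size t + sizeF ts

-- A vertex is addressed by its path from the root: the list of (0-based)
-- child indices followed.  [] is the root.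
Path : Set
Path = List ℕ

mutual
  subtree : Tree → Path → Maybe Tree
  subtree t [] = just t
  subtree (node cs) (i ∷ π) = subtreeF cs i π

  subtreeF : List Tree → ℕ → Path → Maybe Tree
  subtreeF [] i π = nothing
  subtreeF (c ∷ cs) zero π = subtree c π
  subtreeF (c ∷ cs) (suc i) π = subtreeF cs i π

-- Postorder label (1-based) of the vertex at a path, if the path is a vertex.
mutual
  post : Tree → Path → Maybe ℕ
  post t [] = just (size t)
  post (node cs) (i ∷ π) = postF cs i π

  postF : List Tree → ℕ → Path → Maybe ℕ
  postF [] i π = nothing
  postF (c ∷ cs) zero π = post c π
  postF (c ∷ cs) (suc i) π with postF cs i π
  ... | just l = just (size c + l)
  ... | nothing = nothing

-- Removal of a nonroot vertex v (with parent w): delete v and replace v in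
-- the ordered list of children of w by the ordered list of children of v.
mutual
  remove : Tree → Path → Maybe Tree
  remove t [] = nothing
  remove (node cs) (i ∷ π) with removeF cs i π
  ... | just cs' = just (node cs')
  ... | nothing = nothing

  removeF : List Tree → ℕ → Path → Maybe (List Tree)
  removeF [] i π = nothing
  removeF (c ∷ cs) zero [] = just (children c ++ cs)
  removeF (c ∷ cs) zero (j ∷ π) with remove c (j ∷ π)
  ... | just c' = just (c' ∷ cs)
  ... | nothing = nothing
  removeF (c ∷ cs) (suc i) π with removeF cs i π
  ... | just cs' = just (c ∷ cs')
  ... | nothing = nothing

-- The vertex of (remove t u) corresponding to the vertex v ≠ u of t
-- (the vertices of the tree after removal are exactly the vertices v ≠ u).
-- Returns nothing if v = u or u, v are not vertices of t.
mutual
  corr : Tree → Path → Path → Maybe Path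
  corr t [] v = nothing
  corr (node cs) (i ∷ u) v = corrF cs i u v

  corrF : List Tree → ℕ → Path → Path → Maybe Path
  corrF cs i u [] = just []
  corrF cs i u (j ∷ v) = shift cs i u j v 0

  -- k: offset counter (current position in the list)
  shift : List Tree → ℕ → Path → ℕ → Path → ℕ → Maybe Path
  shift [] i u j v k = nothing
  shift (c ∷ cs) zero [] zero [] k = nothing
  shift (c ∷ cs) zero [] zero (m ∷ v) k = just ((k + m) ∷ v)
  shift (c ∷ cs) zero [] (suc j) v k = just ((k + lenC c + j) ∷ v)
    where
    lenC : Tree → ℕ
    lenC (node ds) = Data.List.length ds
  shift (c ∷ cs) zero (x ∷ u) zero v k with corr c (x ∷ u) v
  ... | just v' = just ((k) ∷ v')
  ... | nothing = nothing
  shift (c ∷ cs) zero (x ∷ u) (suc j) v k = just ((k + suc j) ∷ v)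
  shift (c ∷ cs) (suc i) u zero v k = just (k ∷ v)
  shift (c ∷ cs) (suc i) u (suc j) v k = shift cs i u j v (suc k)

IsLeaf : Tree → Set
IsLeaf t = children t ≡ []

IsLeftmost : Path → Set
IsLeftmost v = Σ Path λ σ → v ≡ σ ++ [ 0 ]

IsNotLeftmost : Path → Set
IsNotLeftmost v = Σ Path λ σ → Σ ℕ λ i → v ≡ σ ++ [ suc i ]

data SpecialType : Set where
  [0] [1] [2] : SpecialType

IsSpecial : SpecialType → Tree → Path → Set
IsSpecial [0] t v = Σ Tree λ s → subtree t v ≡ just s × IsLeaf s × IsLeftmost v
IsSpecial [1] t v = Σ Tree λ s → subtree t v ≡ just s × IsLeaf s × IsNotLeftmost v
IsSpecial [2] t v = Σ Tree λ s → subtree t v ≡ just s × (IsLeaf s → ⊥) × IsLeftmost v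

Core : ℕ → ℕ → Tree → Tree → Path → Set
Core d p T' T u =
  size T ≡ suc d × post T u ≡ just p × IsSpecial [1] T u × remove T u ≡ just T'

module Submission where

-- The vertex u of T is a type [1] special vertex, i.e. a leaf that is not a
-- leftmost child, so T' is T with one leaf deleted.  We introduce the inverse
-- operation: 'insertLeaf cs q' adds a new leaf to a forest cs as the right
-- sibling of the vertex with postorder label q.  The proof has three parts.
--   * Existence: for 1 ≤ q ≤ size, 'insertLeaf cs q' contains a non-leftmost
--     leaf with label q + 1 whose removal gives back cs ('insertLeaf-spec').
--   * Uniqueness: removing a non-leftmost leaf of label l and re-inserting a
--     leaf after label l - 1 restores the forest ('insertLeaf-removeLeaf'),
--     so T is determined by T' and p.
--   * Invariance: a vertex v whose label is smaller than that of a leaf u is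
--     neither u nor an ancestor of u, hence lies to the left of u; removing u
--     changes neither the path of v ('corr-left') nor the subtree at v
--     ('subtree-left'), and being special of type τ depends only on these.

open import Defs
open import Data.Nat using (ℕ; zero; suc; _+_; _∸_; _≤_; _<_; s≤s; z≤n)
open import Data.Nat.Properties
open import Data.List using (List; []; _∷_)
open import Data.List.Properties using (∷-injectiveʳ)
open import Data.Maybe using (just; nothing)
open import Data.Product using (Σ; _×_; _,_; proj₁; proj₂)
open import Data.Empty using (⊥; ⊥-elim)
open import Data.Unit using (⊤; tt)
open import Function.Bundles using (_⇔_; mk⇔)
open import Relation.Binary.Definitions using (tri<; tri≈; tri>)
open import Relation.Binary.PropositionalEquality
  using (_≡_; _≢_; refl; sym; trans; cong; subst; module ≡-Reasoning)

postF-there⁻¹ : ∀ c cs i π l → postF (c ∷ cs) (suc i) π ≡ just l →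
  Σ ℕ λ l' → postF cs i π ≡ just l' × l ≡ size c + l'
postF-there⁻¹ c cs i π l e with postF cs i π
postF-there⁻¹ c cs i π l refl | just l' = l' , refl , refl
postF-there⁻¹ c cs i π l () | nothing

removeF-there⁻¹ : ∀ c cs i π cs' → removeF (c ∷ cs) (suc i) π ≡ just cs' →
  Σ (List Tree) λ cs'' → removeF cs i π ≡ just cs'' × cs' ≡ c ∷ cs''
removeF-there⁻¹ c cs i π cs' e with removeF cs i π
removeF-there⁻¹ c cs i π cs' refl | just cs'' = cs'' , refl , refl
removeF-there⁻¹ c cs i π cs' () | nothing

removeF-below⁻¹ : ∀ ds cs j π cs' → removeF (node ds ∷ cs) 0 (j ∷ π) ≡ just cs' →
  Σ (List Tree) λ ds' → removeF ds j π ≡ just ds' × cs' ≡ node ds' ∷ cs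
removeF-below⁻¹ ds cs j π cs' e with removeF ds j π
removeF-below⁻¹ ds cs j π cs' refl | just ds' = ds' , refl , refl
removeF-below⁻¹ ds cs j π cs' () | nothing

remove⁻¹ : ∀ cs i π T' → remove (node cs) (i ∷ π) ≡ just T' →
  Σ (List Tree) λ cs' → removeF cs i π ≡ just cs' × T' ≡ node cs'
remove⁻¹ cs i π T' e with removeF cs i π
remove⁻¹ cs i π T' refl | just cs' = cs' , refl , refl
remove⁻¹ cs i π T' () | nothing

remove-node : ∀ cs i π cs' → removeF cs i π ≡ just cs' → remove (node cs) (i ∷ π) ≡ just (node cs')
remove-node cs i π cs' e rewrite e = refl

mutual
  post-positive : ∀ t π l → post t π ≡ just l → 1 ≤ l
  post-positive (node cs) [] l refl = s≤s z≤n
  post-positive (node cs) (i ∷ π) l e = postF-positive cs i π l e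

  postF-positive : ∀ cs i π l → postF cs i π ≡ just l → 1 ≤ l
  postF-positive (c ∷ cs) zero π l e = post-positive c π l e
  postF-positive (c ∷ cs) (suc i) π l e with postF-there⁻¹ c cs i π l e
  ... | l' , e' , refl = ≤-trans (postF-positive cs i π l' e') (m≤n+m l' (size c))

mutual
  post-≤-size : ∀ t π l → post t π ≡ just l → l ≤ size t
  post-≤-size t [] l refl = ≤-refl
  post-≤-size (node cs) (i ∷ π) l e = m≤n⇒m≤1+n (postF-≤-sizeF cs i π l e)

  postF-≤-sizeF : ∀ cs i π l → postF cs i π ≡ just l → l ≤ sizeF cs
  postF-≤-sizeF (c ∷ cs) zero π l e = ≤-trans (post-≤-size c π l e) (m≤m+n _ _)
  postF-≤-sizeF (c ∷ cs) (suc i) π l e with postF-there⁻¹ c cs i π l e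
  ... | l' , e' , refl = +-monoʳ-≤ (size c) (postF-≤-sizeF cs i π l' e')

label-later-tree : ∀ c cs j ρ ℓ → postF (c ∷ cs) (suc j) ρ ≡ just ℓ → size c < ℓ
label-later-tree c cs j ρ ℓ e with postF-there⁻¹ c cs j ρ ℓ e
... | l' , e' , refl = m<m+n (size c) (postF-positive cs j ρ l' e')

-- 'NotLeftmost i π' says that the vertex at path i ∷ π is not a leftmost
-- child, i.e. the last index of the path is nonzero; it is a structurally
-- recursive form of 'IsNotLeftmost'.
NotLeftmost : ℕ → Path → Set
NotLeftmost i       (j ∷ π) = NotLeftmost j π
NotLeftmost zero    []      = ⊥
NotLeftmost (suc _) []      = ⊤

notLeftmost-suc : ∀ i π → NotLeftmost i π → NotLeftmost (suc i) π
notLeftmost-suc i []      _  = tt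
notLeftmost-suc i (j ∷ π) nl = nl

notLeftmost⇒IsNotLeftmost : ∀ i π → NotLeftmost i π → IsNotLeftmost (i ∷ π)
notLeftmost⇒IsNotLeftmost (suc i) [] _ = [] , i , refl
notLeftmost⇒IsNotLeftmost i (j ∷ π) nl with notLeftmost⇒IsNotLeftmost j π nl
... | σ , k , e = i ∷ σ , k , cong (i ∷_) e

IsNotLeftmost⇒notLeftmost : ∀ i π → IsNotLeftmost (i ∷ π) → NotLeftmost i π
IsNotLeftmost⇒notLeftmost i [] ([] , k , refl) = tt
IsNotLeftmost⇒notLeftmost i [] (_ ∷ [] , k , ())
IsNotLeftmost⇒notLeftmost i [] (_ ∷ _ ∷ _ , k , ())
IsNotLeftmost⇒notLeftmost i (j ∷ π) ([] , k , ())
IsNotLeftmost⇒notLeftmost i (j ∷ π) (_ ∷ σ , k , e) =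
  IsNotLeftmost⇒notLeftmost j π (σ , k , ∷-injectiveʳ e)

-- A vertex that is not a leftmost child has a left sibling, whose subtree
-- precedes it in postorder; so its label is at least 2.
notLeftmost-label : ∀ cs i π l → NotLeftmost i π → postF cs i π ≡ just l → 2 ≤ l
notLeftmost-label (c ∷ cs) zero [] l () e
notLeftmost-label (node ds ∷ cs) zero (j ∷ π) l nl e = notLeftmost-label ds j π l nl e
notLeftmost-label (node ds ∷ cs) (suc i) π l nl e with postF-there⁻¹ (node ds) cs i π l e
... | l' , e' , refl = +-mono-≤ (s≤s (z≤n {sizeF ds})) (postF-positive cs i π l' e')

removeLeaf-sizeF : ∀ cs i π cs' → subtreeF cs i π ≡ just (node []) → removeF cs i π ≡ just cs' →
  sizeF cs ≡ suc (sizeF cs')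
removeLeaf-sizeF (c ∷ cs) zero [] cs' refl refl = refl
removeLeaf-sizeF (node ds ∷ cs) zero (j ∷ π) cs' leaf rem with removeF-below⁻¹ ds cs j π cs' rem
... | ds' , rem' , refl = cong (_+ sizeF cs) (cong suc (removeLeaf-sizeF ds j π ds' leaf rem'))
removeLeaf-sizeF (c ∷ cs) (suc i) π cs' leaf rem with removeF-there⁻¹ c cs i π cs' rem
... | cs'' , rem' , refl =
  trans (cong (size c +_) (removeLeaf-sizeF cs i π cs'' leaf rem')) (+-suc (size c) (sizeF cs''))

-- The vertex with label q of the forest 'node ds ∷ rest'
-- lies strictly inside the first tree if q < size (node ds), is its root if
-- q = size (node ds), and lies in 'rest' otherwise.  The new leaf becomes the
-- right sibling of that vertex; 'insertPos' is the path to the new leaf,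
-- split into its first index and the remaining path.

insertLeaf : List Tree → ℕ → List Tree
insertLeaf [] q = []
insertLeaf (node ds ∷ rest) q with <-cmp q (suc (sizeF ds))
... | tri< _ _ _ = node (insertLeaf ds q) ∷ rest
... | tri≈ _ _ _ = node ds ∷ node [] ∷ rest
... | tri> _ _ _ = node ds ∷ insertLeaf rest (q ∸ suc (sizeF ds))

insertPos : List Tree → ℕ → ℕ × Path
insertPos [] q = 0 , []
insertPos (node ds ∷ rest) q with <-cmp q (suc (sizeF ds))
... | tri< _ _ _ = 0 , (proj₁ (insertPos ds q) ∷ proj₂ (insertPos ds q))
... | tri≈ _ _ _ = 1 , []
... | tri> _ _ _ = suc (proj₁ (insertPos rest (q ∸ suc (sizeF ds))))
                 , proj₂ (insertPos rest (q ∸ suc (sizeF ds)))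

insertLeaf-inside : ∀ ds rest q → q < suc (sizeF ds) →
  insertLeaf (node ds ∷ rest) q ≡ node (insertLeaf ds q) ∷ rest
insertLeaf-inside ds rest q q< with <-cmp q (suc (sizeF ds))
... | tri< _ _ _  = refl
... | tri≈ q≮ _ _ = ⊥-elim (q≮ q<)
... | tri> q≮ _ _ = ⊥-elim (q≮ q<)

insertLeaf-root : ∀ ds rest → insertLeaf (node ds ∷ rest) (suc (sizeF ds)) ≡ node ds ∷ node [] ∷ rest
insertLeaf-root ds rest with <-cmp (suc (sizeF ds)) (suc (sizeF ds))
... | tri< _ q≢ _ = ⊥-elim (q≢ refl)
... | tri≈ _ _ _  = refl
... | tri> _ q≢ _ = ⊥-elim (q≢ refl)

insertLeaf-after : ∀ ds rest q → suc (sizeF ds) < q →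
  insertLeaf (node ds ∷ rest) q ≡ node ds ∷ insertLeaf rest (q ∸ suc (sizeF ds))
insertLeaf-after ds rest q q> with <-cmp q (suc (sizeF ds))
... | tri< _ _ q≯ = ⊥-elim (q≯ q>)
... | tri≈ _ _ q≯ = ⊥-elim (q≯ q>)
... | tri> _ _ _  = refl

InsertionSpec : List Tree → ℕ → Set
InsertionSpec cs q =
  postF (insertLeaf cs q) (proj₁ (insertPos cs q)) (proj₂ (insertPos cs q)) ≡ just (suc q)
  × subtreeF (insertLeaf cs q) (proj₁ (insertPos cs q)) (proj₂ (insertPos cs q)) ≡ just (node [])
  × NotLeftmost (proj₁ (insertPos cs q)) (proj₂ (insertPos cs q))
  × removeF (insertLeaf cs q) (proj₁ (insertPos cs q)) (proj₂ (insertPos cs q)) ≡ just cs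
  × sizeF (insertLeaf cs q) ≡ suc (sizeF cs)

insertLeaf-spec : ∀ cs q → 1 ≤ q → q ≤ sizeF cs → InsertionSpec cs q
insertLeaf-spec [] zero () _
insertLeaf-spec [] (suc q) _ ()
insertLeaf-spec (node ds ∷ rest) q 1≤q q≤ with <-cmp q (suc (sizeF ds))
... | tri< (s≤s q≤ds) _ _ with insertLeaf-spec ds q 1≤q q≤ds
...   | lab , leaf , nl , rem , sz rewrite rem | sz = lab , leaf , nl , refl , refl
insertLeaf-spec (node ds ∷ rest) q 1≤q q≤ | tri≈ _ refl _ =
  cong just (+-comm (suc (sizeF ds)) 1) , refl , tt , refl , +-suc (suc (sizeF ds)) (sizeF rest)
insertLeaf-spec (node ds ∷ rest) q 1≤q q≤ | tri> _ _ q>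
  with insertLeaf-spec rest (q ∸ suc (sizeF ds)) (m<n⇒0<n∸m q>) (m≤n+o⇒m∸n≤o q (suc (sizeF ds)) q≤)
... | lab , leaf , nl , rem , sz rewrite lab | rem | sz =
  cong just (trans (+-suc (suc (sizeF ds)) _) (cong suc (m+[n∸m]≡n (<⇒≤ q>)))) ,
  leaf , notLeftmost-suc (proj₁ pos) (proj₂ pos) nl , refl , +-suc (suc (sizeF ds)) (sizeF rest)
  where
  pos : ℕ × Path
  pos = insertPos rest (q ∸ suc (sizeF ds))

-- The leaf either lies inside the first
-- tree, is the second tree (its left sibling being the first tree), or lies
-- further right; in the last case it is not leftmost among the later trees.
mutual
  insertLeaf-removeLeaf : ∀ cs i π l cs' → NotLeftmost i π → subtreeF cs i π ≡ just (node []) →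
    postF cs i π ≡ just l → removeF cs i π ≡ just cs' → insertLeaf cs' (l ∸ 1) ≡ cs
  insertLeaf-removeLeaf (c ∷ cs) zero [] l cs' () leaf lab rem
  insertLeaf-removeLeaf (node ds ∷ cs) zero (j ∷ π) l cs' nl leaf lab rem
    with removeF-below⁻¹ ds cs j π cs' rem
  ... | ds' , rem' , refl =
    trans (insertLeaf-inside ds' cs (l ∸ 1) inside)
          (cong (λ es → node es ∷ cs) (insertLeaf-removeLeaf ds j π l ds' nl leaf lab rem'))
    where
    inside : l ∸ 1 < suc (sizeF ds')
    inside = s≤s (subst (λ n → l ∸ 1 ≤ n ∸ 1) (removeLeaf-sizeF ds j π ds' leaf rem')
                        (∸-monoˡ-≤ 1 (postF-≤-sizeF ds j π l lab)))
  insertLeaf-removeLeaf (node ds ∷ _ ∷ cs) (suc zero) [] _ _ nl refl refl refl =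
    trans (cong (insertLeaf (node ds ∷ cs)) (m+n∸n≡m (suc (sizeF ds)) 1)) (insertLeaf-root ds cs)
  insertLeaf-removeLeaf (c ∷ cs) (suc (suc i)) [] l cs' nl leaf lab rem =
    insertLeaf-removeLeaf-later c cs (suc i) [] l cs' tt leaf lab rem
  insertLeaf-removeLeaf (c ∷ cs) (suc i) (j ∷ π) l cs' nl leaf lab rem =
    insertLeaf-removeLeaf-later c cs i (j ∷ π) l cs' nl leaf lab rem

  insertLeaf-removeLeaf-later : ∀ c cs i π l cs' → NotLeftmost i π → subtreeF cs i π ≡ just (node []) →
    postF (c ∷ cs) (suc i) π ≡ just l → removeF (c ∷ cs) (suc i) π ≡ just cs' → insertLeaf cs' (l ∸ 1) ≡ c ∷ cs
  insertLeaf-removeLeaf-later (node ds) cs i π l cs' nl leaf lab rem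
    with postF-there⁻¹ (node ds) cs i π l lab | removeF-there⁻¹ (node ds) cs i π cs' rem
  ... | l' , lab' , refl | cs'' , rem' , refl = begin
    insertLeaf (node ds ∷ cs'') (n + l' ∸ 1)      ≡⟨ cong (insertLeaf (node ds ∷ cs'')) (+-∸-assoc n 1≤l') ⟩
    insertLeaf (node ds ∷ cs'') (n + (l' ∸ 1))    ≡⟨ insertLeaf-after ds cs'' (n + (l' ∸ 1)) (m<m+n n (m<n⇒0<n∸m 2≤l')) ⟩
    node ds ∷ insertLeaf cs'' (n + (l' ∸ 1) ∸ n)  ≡⟨ cong (λ q → node ds ∷ insertLeaf cs'' q) (m+n∸m≡n n (l' ∸ 1)) ⟩
    node ds ∷ insertLeaf cs'' (l' ∸ 1)            ≡⟨ cong (node ds ∷_) (insertLeaf-removeLeaf cs i π l' cs'' nl leaf lab' rem') ⟩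
    node ds ∷ cs                                  ∎
    where
    open ≡-Reasoning
    n : ℕ
    n = suc (sizeF ds)
    2≤l' : 2 ≤ l'
    2≤l' = notLeftmost-label cs i π l' nl lab'
    1≤l' : 1 ≤ l'
    1≤l' = ≤-trans (s≤s z≤n) 2≤l'

-- A vertex v = (j , ρ) whose label is smaller than the label of a leaf
-- u = (i , π) lies to the left of u.  Removing u keeps the path of v
-- (the offset k accounts for siblings already passed by 'shift') ...
corr-left : ∀ cs i π j ρ k p ℓ → postF cs i π ≡ just p → postF cs j ρ ≡ just ℓ → ℓ < p →
  subtreeF cs i π ≡ just (node []) → shift cs i π j ρ k ≡ just ((k + j) ∷ ρ)
corr-left (c ∷ cs) zero [] zero [] k p ℓ refl refl ℓ<p leaf = ⊥-elim (<-irrefl refl ℓ<p)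
corr-left (c ∷ cs) zero [] zero (m ∷ ρ) k p ℓ lu () ℓ<p refl
corr-left (c ∷ cs) zero π (suc j) ρ k p ℓ lu lv ℓ<p leaf =
  ⊥-elim (≤⇒≯ (post-≤-size c π p lu) (<-trans (label-later-tree c cs j ρ ℓ lv) ℓ<p))
corr-left (node ds ∷ cs) zero (x ∷ π) zero [] k p ℓ lu refl ℓ<p leaf =
  ⊥-elim (≤⇒≯ (m≤n⇒m≤1+n (postF-≤-sizeF ds x π p lu)) ℓ<p)
corr-left (node ds ∷ cs) zero (x ∷ π) zero (m ∷ ρ) k p ℓ lu lv ℓ<p leaf
  rewrite corr-left ds x π m ρ 0 p ℓ lu lv ℓ<p leaf | +-identityʳ k = refl
corr-left (c ∷ cs) (suc i) π zero ρ k p ℓ lu lv ℓ<p leaf rewrite +-identityʳ k = refl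
corr-left (c ∷ cs) (suc i) π (suc j) ρ k p ℓ lu lv ℓ<p leaf
  with postF-there⁻¹ c cs i π p lu | postF-there⁻¹ c cs j ρ ℓ lv
... | p' , lu' , refl | ℓ' , lv' , refl
  rewrite corr-left cs i π j ρ (suc k) p' ℓ' lu' lv' (+-cancelˡ-< (size c) ℓ' p' ℓ<p) leaf
        | +-suc k j = refl

subtree-left : ∀ cs i π j ρ p ℓ cs' → postF cs i π ≡ just p → postF cs j ρ ≡ just ℓ → ℓ < p →
  subtreeF cs i π ≡ just (node []) → removeF cs i π ≡ just cs' → subtreeF cs' j ρ ≡ subtreeF cs j ρ
subtree-left (c ∷ cs) zero [] zero [] p ℓ cs' refl refl ℓ<p leaf rem = ⊥-elim (<-irrefl refl ℓ<p)
subtree-left (c ∷ cs) zero [] zero (m ∷ ρ) p ℓ cs' lu () ℓ<p refl rem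
subtree-left (c ∷ cs) zero π (suc j) ρ p ℓ cs' lu lv ℓ<p leaf rem =
  ⊥-elim (≤⇒≯ (post-≤-size c π p lu) (<-trans (label-later-tree c cs j ρ ℓ lv) ℓ<p))
subtree-left (node ds ∷ cs) zero (x ∷ π) zero [] p ℓ cs' lu refl ℓ<p leaf rem =
  ⊥-elim (≤⇒≯ (m≤n⇒m≤1+n (postF-≤-sizeF ds x π p lu)) ℓ<p)
subtree-left (node ds ∷ cs) zero (x ∷ π) zero (m ∷ ρ) p ℓ cs' lu lv ℓ<p leaf rem
  with removeF-below⁻¹ ds cs x π cs' rem
... | ds' , rem' , refl = subtree-left ds x π m ρ p ℓ ds' lu lv ℓ<p leaf rem'
subtree-left (c ∷ cs) (suc i) π zero ρ p ℓ cs' lu lv ℓ<p leaf rem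
  with removeF-there⁻¹ c cs i π cs' rem
... | cs'' , _ , refl = refl
subtree-left (c ∷ cs) (suc i) π (suc j) ρ p ℓ cs' lu lv ℓ<p leaf rem
  with postF-there⁻¹ c cs i π p lu | postF-there⁻¹ c cs j ρ ℓ lv | removeF-there⁻¹ c cs i π cs' rem
... | p' , lu' , refl | ℓ' , lv' , refl | cs'' , rem' , refl =
  subtree-left cs i π j ρ p' ℓ' cs'' lu' lv' (+-cancelˡ-< (size c) ℓ' p' ℓ<p) leaf rem'

special-subtree : ∀ τ t t' v → subtree t' v ≡ subtree t v → IsSpecial τ t v → IsSpecial τ t' v
special-subtree [0] t t' v e (s , sub , leaf , pos) = s , trans e sub , leaf , pos
special-subtree [1] t t' v e (s , sub , leaf , pos) = s , trans e sub , leaf , pos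
special-subtree [2] t t' v e (s , sub , leaf , pos) = s , trans e sub , leaf , pos

addLeaf : Tree → ℕ → Tree
addLeaf (node cs) p = node (insertLeaf cs (p ∸ 1))

addLeaf-core : ∀ T' p → 2 ≤ p → p ≤ size T' → Σ Path λ u → Core (size T') p T' (addLeaf T' p) u
addLeaf-core (node cs) (suc q) (s≤s 1≤q) (s≤s q≤) with insertLeaf-spec cs q 1≤q q≤
... | lab , leaf , nl , rem , sz =
  (proj₁ (insertPos cs q) ∷ proj₂ (insertPos cs q)) ,
  cong suc sz , lab , (node [] , leaf , refl , notLeftmost⇒IsNotLeftmost _ _ nl) ,
  remove-node (insertLeaf cs q) _ _ cs rem

core-addLeaf : ∀ d p T' T u → Core d p T' T u → T ≡ addLeaf T' p
core-addLeaf d p T' (node cs) [] (_ , _ , _ , ())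
core-addLeaf d p T' (node cs) (i ∷ π) (_ , lab , (node [] , leaf , refl , nl) , rem)
  with remove⁻¹ cs i π T' rem
... | cs' , rem' , refl =
  cong node (sym (insertLeaf-removeLeaf cs i π p cs' (IsNotLeftmost⇒notLeftmost i π nl) leaf lab rem'))

-- Invariance: removing a leaf u of label p preserves the special type of
-- every vertex v of label less than p (the root cannot occur, its label
-- being the maximal one).
special-left-of-leaf : ∀ T u T' p → post T u ≡ just p → subtree T u ≡ just (node []) →
  remove T u ≡ just T' → (τ : SpecialType) (v : Path) (ℓ : ℕ) → post T v ≡ just ℓ → ℓ < p →
  IsSpecial τ T v ⇔ (Σ Path λ v' → corr T u v ≡ just v' × IsSpecial τ T' v')
special-left-of-leaf T [] T' p lu leaf ()
special-left-of-leaf T (i ∷ π) T' p lu leaf rem τ [] ℓ refl ℓ<p =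
  ⊥-elim (≤⇒≯ (post-≤-size T (i ∷ π) p lu) ℓ<p)
special-left-of-leaf (node cs) (i ∷ π) T' p lu leaf rem τ (j ∷ ρ) ℓ lv ℓ<p
  with remove⁻¹ cs i π T' rem
... | cs' , rem' , refl = mk⇔ forth back
  where
  same-path : corr (node cs) (i ∷ π) (j ∷ ρ) ≡ just (j ∷ ρ)
  same-path = corr-left cs i π j ρ 0 p ℓ lu lv ℓ<p leaf
  same-subtree : subtree (node cs') (j ∷ ρ) ≡ subtree (node cs) (j ∷ ρ)
  same-subtree = subtree-left cs i π j ρ p ℓ cs' lu lv ℓ<p leaf rem'
  forth : IsSpecial τ (node cs) (j ∷ ρ) →
    Σ Path λ v' → corr (node cs) (i ∷ π) (j ∷ ρ) ≡ just v' × IsSpecial τ (node cs') v'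
  forth sp = j ∷ ρ , same-path , special-subtree τ (node cs) (node cs') (j ∷ ρ) same-subtree sp
  back : (Σ Path λ v' → corr (node cs) (i ∷ π) (j ∷ ρ) ≡ just v' × IsSpecial τ (node cs') v') →
    IsSpecial τ (node cs) (j ∷ ρ)
  back (v' , c , sp) with trans (sym same-path) c
  ... | refl = special-subtree τ (node cs') (node cs) (j ∷ ρ) (sym same-subtree) sp

corollary3p9 : (d : ℕ) (T' : Tree) → size T' ≡ d → (p : ℕ) → 2 ≤ p → p ≤ d →
    (Σ Tree λ T → Σ Path λ u → Core d p T' T u)
    × ((T₁ T₂ : Tree) (u₁ u₂ : Path) → Core d p T' T₁ u₁ → Core d p T' T₂ u₂ → T₁ ≡ T₂)
    × ((T : Tree) (u : Path) → Core d p T' T u →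
        (τ : SpecialType) (v : Path) (ℓ : ℕ) → v ≢ [] → v ≢ u →
        post T v ≡ just ℓ → ℓ ≤ p ∸ 1 →
        (IsSpecial τ T v ⇔ (Σ Path λ v' → corr T u v ≡ just v' × IsSpecial τ T' v')))
corollary3p9 .(size T') T' refl (suc q) 2≤p p≤d =
  (addLeaf T' (suc q) , addLeaf-core T' (suc q) 2≤p p≤d) ,
  (λ T₁ T₂ u₁ u₂ core₁ core₂ →
     trans (core-addLeaf _ _ T' T₁ u₁ core₁) (sym (core-addLeaf _ _ T' T₂ u₂ core₂))) ,
  (λ { T u (_ , lab , (node _ , leaf , refl , _) , rem) τ v ℓ _ _ lv ℓ≤q →
     special-left-of-leaf T u T' (suc q) lab leaf rem τ v ℓ lv (s≤s ℓ≤q) })
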